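{- For every named $\mathrm{GS4}$ derivation $P$ with conclusion $\vdash\Gamma$, $V_{\langle\!\langle P\rangle\!\rangle}=\mathrm{names}(\Gamma)$ and $\mathrm{Br}(\langle\!\langle P\rangle\!\rangle)\subseteq\mathrm{Br}(\Gamma)$.
   Context: Named formulas and sequents. Fix a countably infinite set $\mathcal N$ of names and a set $\mathcal A$ of atoms with a fixpoint-free involution $\alpha\mapsto\bar\alpha$. Named formulas: $A,B::=\alpha^x\mid A\lor B\mid A\land B$ ($\alpha\in\mathcal A$, $x\in\mathcal N$); formulas $\alpha^x$ are atomic. Negation: $\overline{\alpha^x}=\bar\alpha^x$, $\overline{A\lor B}=\bar A\land\bar B$, $\overline{A\land B}=\bar A\lor\bar B$ (names preserved). $\mathrm{names}(A)$ is the set of names in $A$, $\mathrm{names}(\Gamma)=\bigcup_{A\in\Gamma}\mathrm{names}(A)$. $A\equiv B$ means $A,B$ coincide after erasing names. A formula is sharing-free if each name occurs in it at most once; a set is sharing-free if its members are sharing-free with pairwise disjoint name sets. A sequent $\vdash\Gamma$ is a finite sharing-free set $\Gamma$; in comma notation the components have pairwise disjoint name sets and $\Gamma,A=\Gamma\cup\{A\}$. Derivations. Named $\mathrm{GS4}$ derivations are finite trees of rule applications labelled with sharing-free sequents: axiom $\mathrm{ax}_{\{A,\bar B\}}$ (no premisses, conclusion $\vdash\Gamma,A,\bar B$, $A\equiv B$); cut (premisses $\vdash\Gamma,A$, $\vdash\Gamma,\bar A$, conclusion $\vdash\Gamma$); superposition $\sqcup$ (premisses $\vdash\Gamma$, $\vdash\Gamma$,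 conclusion $\vdash\Gamma$); $\lor$ (premiss $\vdash\Gamma,A,B$, conclusion $\vdash\Gamma,A\lor B$); $\land$ (premisses $\vdash\Gamma,A$, $\vdash\Gamma,B$, conclusion $\vdash\Gamma,A\land B$). Branches. $\mathrm{Br}(\alpha^x)=\{\{x\}\}$, $\mathrm{Br}(B\lor C)=\{X\cup Y\mid X\in\mathrm{Br}(B),Y\in\mathrm{Br}(C)\}$, $\mathrm{Br}(B\land C)=\mathrm{Br}(B)\cup\mathrm{Br}(C)$; for sharing-free $\Gamma$, $\mathrm{Br}(\Gamma)=\{X\subseteq\mathrm{names}(\Gamma)\mid\forall A\in\Gamma,\ X\cap\mathrm{names}(A)\in\mathrm{Br}(A)\}$. Branch-labeled graphs. A bl-graph is $G=\langle V_G,\triangleleft_G\rangle$ with $V_G\subseteq\mathcal N$ and $\triangleleft_G$ a relation between 2-element subsets $e$ of $V_G$ and subsets $X\subseteq V_G$ such that $e\triangleleft_G X$ implies $e\subseteq X$. $E_G=\{e\mid\exists X.\,e\triangleleft_G X\}$, $\mathrm{Br}(G)=\{X\mid\exists e.\,e\triangleleft_G X\}$. Union $\sqcup$ is componentwise union. For $I\subseteq\mathcal N$: $e\triangleleft^I_G X$ iff $e\triangleleft_G Y$ for some $Y$ with $X=Y\setminus I$. An alternating $X$-labeled path between bl-graphs $G,H$ through $I$ is a sequence $x_1,\dots,x_n$ ($n>1$) of pairwise distinct vertices of $G$ or $H$ with $x_i\in I$ for $1<i<n$ such that either $x_ix_{i+1}\triangleleft^I_G X$ for all odd $i$ and $x_ix_{i+1}\triangleleft^I_H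 X$ for all even $i$, or the same with $G,H$ swapped; it is complete if $x_1,x_n\notin I$. $G\odot_I H$ has vertex set $V=(V_G\cup V_H)\setminus I$ and, for $x\ne y\in V$ and $X\subseteq V$, $xy\triangleleft X$ iff there is a complete alternating $X$-labeled path from $x$ to $y$ between $G$ and $H$ through $I$; $\odot_A=\odot_{\mathrm{names}(A)}$. $\mathrm{wk}_\Gamma(G)=\langle V_G\cup\mathrm{names}(\Gamma),\{(e,X\cup Y)\mid e\triangleleft_G X,\,Y\in\mathrm{Br}(\Gamma)\}\rangle$. $\mathrm{id}_{\{\alpha^x,\bar\alpha^y\}}=\langle\{x,y\},\{(xy,\{x,y\})\}\rangle$, and for disjoint sharing-free $A_1\lor A_2$, $\bar B_1\land\bar B_2$ with $A_i\equiv B_i$, $\mathrm{id}_{\{A_1\lor A_2,\bar B_1\land\bar B_2\}}=\mathrm{wk}_{\{A_2\}}(\mathrm{id}_{\{A_1,\bar B_1\}})\sqcup\mathrm{wk}_{\{A_1\}}(\mathrm{id}_{\{A_2,\bar B_2\}})$ (every axiom pair of non-atomic formulas is an unordered pair of this shape). The branch-labeled axiom graph $\langle\!\langle P\rangle\!\rangle$ is $\mathrm{wk}_\Gamma(\mathrm{id}_{\{A,\bar B\}})$ for an axiom $\mathrm{ax}_{\{A,\bar B\}}$ with conclusion $\vdash\Gamma,A,\bar B$; $\langle\!\langle Q\rangle\!\rangle\odot_A\langle\!\langle R\rangle\!\rangle$ for a cut with premiss derivations $Q$ of $\vdash\Gamma,A$, $R$ of $\vdash\Gamma,\bar A$; the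 union of the premisses' bl-graphs for $\sqcup,\lor,\land$. -}

module Defs where

open import Data.Nat using (ℕ; _≡ᵇ_)
open import Data.Bool using (Bool; true; false; T; _∨_; _∧_; not)
open import Data.Unit using (⊤)
open import Data.Empty using (⊥)
open import Data.Product using (Σ; ∃; ∃-syntax; _×_; _,_)
open import Data.Sum using (_⊎_)
open import Data.List using (List; []; _∷_; _∷ʳ_; foldr)
open import Data.List.Relation.Unary.All using (All)
open import Data.List.Relation.Unary.Unique.Propositional using (Unique)
open import Data.List.Membership.Propositional using (_∈_)
open import Data.List.Relation.Binary.Permutation.Propositional using (_↭_)
open import Relation.Binary.PropositionalEquality using (_≡_; _≢_)

Name : Set
Name = ℕ

Subset : Set
Subset = Name → Bool

_∈ˢ_ : Name → Subset → Set
x ∈ˢ X = T (X x)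

_∉ˢ_ : Name → Subset → Set
x ∉ˢ X = x ∈ˢ X → ⊥

_≐_ : Subset → Subset → Set
X ≐ Y = ∀ n → X n ≡ Y n

_⊆ˢ_ : Subset → Subset → Set
X ⊆ˢ Y = ∀ n → n ∈ˢ X → n ∈ˢ Y

∅ˢ : Subset
∅ˢ _ = false

｛_｝ : Name → Subset
｛ x ｝ n = n ≡ᵇ x

_∪ˢ_ : Subset → Subset → Subset
(X ∪ˢ Y) n = X n ∨ Y n

_∩ˢ_ : Subset → Subset → Subset
(X ∩ˢ Y) n = X n ∧ Y n

_∖ˢ_ : Subset → Subset → Subset
(X ∖ˢ Y) n = X n ∧ not (Y n)

Disjoint : Subset → Subset → Set
Disjoint X Y = ∀ n → n ∈ˢ X → n ∈ˢ Y → ⊥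

record AtomSys : Set₁ where
  field
    Atom    : Set
    bar     : Atom → Atom
    bar-inv : ∀ a → bar (bar a) ≡ a
    bar-fpf : ∀ a → bar a ≢ a

-- A bl-graph: vertex set V and relation  {x,y} ◁ X, written  rel x y X.
-- (2-element subsets {x,y} are given by either ordering of x ≢ y.)

record BLGraph : Set₁ where
  field
    V   : Subset
    rel : Name → Name → Subset → Set
open BLGraph public

BrG : BLGraph → Subset → Set
BrG G X = ∃[ x ] ∃[ y ] rel G x y X

_⊔G_ : BLGraph → BLGraph → BLGraph
G ⊔G H = record { V = V G ∪ˢ V H ; rel = λ x y X → rel G x y X ⊎ rel H x y X }

relI : BLGraph → Subset → Name → Name → Subset → Set
relI G I x y X = ∃[ Y ] (rel G x y Y × X ≐ (Y ∖ˢ I))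

Alt : BLGraph → BLGraph → Subset → Subset → List Name → Set
Alt G H I X (x ∷ y ∷ [])       = relI G I x y X
Alt G H I X (x ∷ y ∷ z ∷ rest) = relI G I x y X × Alt H G I X (y ∷ z ∷ rest)
Alt G H I X _                  = ⊥

CompletePath : BLGraph → BLGraph → Subset → Subset → Name → Name → Set
CompletePath G H I X x y =
  ∃[ mids ]
    ( Unique (x ∷ (mids ∷ʳ y))
    × All (λ z → z ∈ˢ (V G ∪ˢ V H)) (x ∷ (mids ∷ʳ y))
    × All (λ z → z ∈ˢ I) mids
    × x ∉ˢ I × y ∉ˢ I
    × (Alt G H I X (x ∷ (mids ∷ʳ y)) ⊎ Alt H G I X (x ∷ (mids ∷ʳ y))) )

comp : Subset → BLGraph → BLGraph → BLGraph
comp I G H = record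
  { V   = (V G ∪ˢ V H) ∖ˢ I
  ; rel = λ x y X → x ≢ y × x ∈ˢ ((V G ∪ˢ V H) ∖ˢ I) × y ∈ˢ ((V G ∪ˢ V H) ∖ˢ I)
                    × X ⊆ˢ ((V G ∪ˢ V H) ∖ˢ I) × CompletePath G H I X x y
  }

module WithAtoms (𝒜 : AtomSys) where
  open AtomSys 𝒜

  infixr 6 _∨F_
  infixr 7 _∧F_

  data Fm : Set where
    atom : Atom → Name → Fm
    _∨F_ : Fm → Fm → Fm
    _∧F_ : Fm → Fm → Fm

  data UFm : Set where
    uatom : Atom → UFm
    _∨U_  : UFm → UFm → UFm
    _∧U_  : UFm → UFm → UFm

  erase : Fm → UFm
  erase (atom a x) = uatom a
  erase (A ∨F B)   = erase A ∨U erase B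
  erase (A ∧F B)   = erase A ∧U erase B

  _≅_ : Fm → Fm → Set
  A ≅ B = erase A ≡ erase B

  neg : Fm → Fm
  neg (atom a x) = atom (bar a) x
  neg (A ∨F B)   = neg A ∧F neg B
  neg (A ∧F B)   = neg A ∨F neg B

  names : Fm → Subset
  names (atom a x) = ｛ x ｝
  names (A ∨F B)   = names A ∪ˢ names B
  names (A ∧F B)   = names A ∪ˢ names B

  namesL : List Fm → Subset
  namesL = foldr (λ A X → names A ∪ˢ X) ∅ˢ

  SF : Fm → Set
  SF (atom a x) = ⊤
  SF (A ∨F B)   = SF A × SF B × Disjoint (names A) (names B)
  SF (A ∧F B)   = SF A × SF B × Disjoint (names A) (names B)

  SFL : List Fm → Set
  SFL []      = ⊤
  SFL (A ∷ Γ) = SF A × Disjoint (names A) (namesL Γ) × SFL Γ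

  BrF : Fm → Subset → Set
  BrF (atom a x) X = X ≐ ｛ x ｝
  BrF (A ∨F B)   X = ∃[ Y ] ∃[ Z ] (BrF A Y × BrF B Z × X ≐ (Y ∪ˢ Z))
  BrF (A ∧F B)   X = BrF A X ⊎ BrF B X

  BrL : List Fm → Subset → Set
  BrL Γ X = X ⊆ˢ namesL Γ × (∀ {A} → A ∈ Γ → BrF A (X ∩ˢ names A))

  wk : List Fm → BLGraph → BLGraph
  wk Γ G = record
    { V   = V G ∪ˢ namesL Γ
    ; rel = λ x y Z → ∃[ X ] ∃[ Y ] (rel G x y X × BrL Γ Y × Z ≐ (X ∪ˢ Y))
    }

  emptyG : BLGraph
  emptyG = record { V = ∅ˢ ; rel = λ _ _ _ → ⊥ }

  idG : Fm → Fm → BLGraph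
  idG (atom a x) (atom b y) = record
    { V   = ｛ x ｝ ∪ˢ ｛ y ｝
    ; rel = λ u v X → ((u ≡ x × v ≡ y) ⊎ (u ≡ y × v ≡ x)) × X ≐ (｛ x ｝ ∪ˢ ｛ y ｝)
    }
  idG (A₁ ∨F A₂) (C₁ ∧F C₂) = wk (A₂ ∷ []) (idG A₁ C₁) ⊔G wk (A₁ ∷ []) (idG A₂ C₂)
  idG (C₁ ∧F C₂) (A₁ ∨F A₂) = wk (A₂ ∷ []) (idG A₁ C₁) ⊔G wk (A₁ ∷ []) (idG A₂ C₂)
  idG _ _ = emptyG

  -- A sequent ⊢ Γ is a list without repetition;
  -- a conclusion written "Γ , A" is any list that is a permutation of A ∷ Γ.

  data Deriv : List Fm → Set where
    ax   : ∀ {Γ} Δ A B → Γ ↭ (A ∷ neg B ∷ Δ) → A ≅ B → SFL Γ → Deriv Γ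
    cut  : ∀ {Γ} A → Deriv (A ∷ Γ) → Deriv (neg A ∷ Γ) → SFL Γ → Deriv Γ
    sup  : ∀ {Γ} → Deriv Γ → Deriv Γ → SFL Γ → Deriv Γ
    orR  : ∀ {Γ} Δ A B → Γ ↭ ((A ∨F B) ∷ Δ) → Deriv (A ∷ B ∷ Δ) → SFL Γ → Deriv Γ
    andR : ∀ {Γ} Δ A B → Γ ↭ ((A ∧F B) ∷ Δ) → Deriv (A ∷ Δ) → Deriv (B ∷ Δ)
           → SFL Γ → Deriv Γ

  graph : ∀ {Γ} → Deriv Γ → BLGraph
  graph (ax Δ A B _ _ _)     = wk Δ (idG A (neg B))
  graph (cut A Q R _)        = comp (names A) (graph Q) (graph R)
  graph (sup Q R _)          = graph Q ⊔G graph R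
  graph (orR _ _ _ _ Q _)    = graph Q
  graph (andR _ _ _ _ Q R _) = graph Q ⊔G graph R

-- Each rule acts on branch labels the way it acts on branches:
-- the ∨-rule changes nothing (a branch of A , B restricted to names A ∪ names B is a branch of
-- A ∨ B), ∧ and superposition take unions, weakening joins a branch of the new formulas to
-- every label, and a cut removes the names of the cut formula from the label of a premiss edge.
-- Sharing-freeness of the conclusions is what makes these operations commute with restricting
-- a label to the names of each formula.  The identity graph of a pair A₁ ∨ A₂ , B₁ ∧ B₂ is the
-- graph of the η-expanded axiom (two weakened axioms followed by ∨ and ∧), so it is handled by
-- the same steps.

module Submission where

open import Defs
open import Algebra.Bundles using (CommutativeMonoid)
open import Data.Bool using (true; false; T; _∨_; _∧_; not)
open import Data.Bool.Properties
  using ( ∨-assoc; ∨-comm; ∨-idem; ∨-identityʳ; ∧-comm; ∧-zeroʳ; ∧-identityʳ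
        ; ∧-distribˡ-∨; ∧-abs-∨; T-∨; ∨-commutativeMonoid; ∨-idempotentCommutativeMonoid )
open import Algebra.Properties.CommutativeSemigroup
  (CommutativeMonoid.commutativeSemigroup ∨-commutativeMonoid) using (x∙yz≈y∙xz)
open import Algebra.Properties.IdempotentCommutativeMonoid ∨-idempotentCommutativeMonoid
  using (∙-distrʳ-∙)
open import Data.Empty using (⊥; ⊥-elim)
open import Data.Unit using (tt)
open import Data.Product using (∃-syntax; _×_; _,_; proj₁; proj₂)
open import Data.Sum using (_⊎_; inj₁; inj₂; [_,_]′)
open import Data.List using (List; []; _∷_; _++_)
open import Data.List.Membership.Propositional using (_∈_)
open import Data.List.Membership.Propositional.Properties using (∈-++⁻)
open import Data.List.Relation.Unary.Any using (here; there)
open import Data.List.Relation.Binary.Permutation.Propositional as ↭ using (_↭_; prep; swap; ↭-sym)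
open import Data.List.Relation.Binary.Permutation.Propositional.Properties using (∈-resp-↭)
open import Function using (_∘_)
open import Function.Bundles using (Equivalence)
open import Relation.Binary.PropositionalEquality using (_≡_; refl; sym; trans; cong; cong₂; subst)

private
  variable
    W X Y Z : Subset

≐-sym : X ≐ Y → Y ≐ X
≐-sym e n = sym (e n)

≐-trans : X ≐ Y → Y ≐ Z → X ≐ Z
≐-trans e f n = trans (e n) (f n)

≐⇒⊆ : X ≐ Y → X ⊆ˢ Y
≐⇒⊆ e n = subst T (e n)

⊆-refl : X ⊆ˢ X
⊆-refl _ x = x

⊆-trans : X ⊆ˢ Y → Y ⊆ˢ Z → X ⊆ˢ Z
⊆-trans p q n x = q n (p n x)

⊆-∪ˡ : X ⊆ˢ (X ∪ˢ Y)
⊆-∪ˡ _ x = Equivalence.from T-∨ (inj₁ x)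

⊆-∪ʳ : Y ⊆ˢ (X ∪ˢ Y)
⊆-∪ʳ _ y = Equivalence.from T-∨ (inj₂ y)

∪-⊆ : X ⊆ˢ Z → Y ⊆ˢ Z → (X ∪ˢ Y) ⊆ˢ Z
∪-⊆ p q n xy = [ p n , q n ]′ (Equivalence.to T-∨ xy)

∪-mono : W ⊆ˢ X → Y ⊆ˢ Z → (W ∪ˢ Y) ⊆ˢ (X ∪ˢ Z)
∪-mono p q = ∪-⊆ (⊆-trans p ⊆-∪ˡ) (⊆-trans q ⊆-∪ʳ)

Disjoint-sym : Disjoint X Y → Disjoint Y X
Disjoint-sym d n y x = d n x y

Disjoint-mono : W ⊆ˢ X → Y ⊆ˢ Z → Disjoint X Z → Disjoint W Y
Disjoint-mono p q d n w y = d n (p n w) (q n y)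

Disjoint-∪ˡ : Disjoint X Z → Disjoint Y Z → Disjoint (X ∪ˢ Y) Z
Disjoint-∪ˡ d e n xy z = [ (λ x → d n x z) , (λ y → e n y z) ]′ (Equivalence.to T-∨ xy)

Disjoint-∪ʳ : Disjoint X Y → Disjoint X Z → Disjoint X (Y ∪ˢ Z)
Disjoint-∪ʳ d e = Disjoint-sym (Disjoint-∪ˡ (Disjoint-sym d) (Disjoint-sym e))

Disjoint-∅ʳ : Disjoint X ∅ˢ
Disjoint-∅ʳ _ _ ()

∪-∩-disjointʳ : ∀ {X Y Z} → Disjoint Y Z → ((X ∪ˢ Y) ∩ˢ Z) ≐ (X ∩ˢ Z)
∪-∩-disjointʳ {X} {Y} {Z} d n = cancel (X n) (Y n) (Z n) (d n)
  where
  cancel : ∀ x y z → (T y → T z → ⊥) → (x ∨ y) ∧ z ≡ x ∧ z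
  cancel x false z _   = cong (_∧ z) (∨-identityʳ x)
  cancel x true false _ = trans (∧-zeroʳ _) (sym (∧-zeroʳ x))
  cancel x true true y⊥z = ⊥-elim (y⊥z tt tt)

∪-∩-disjointˡ : ∀ {X Y Z} → Disjoint X Z → ((X ∪ˢ Y) ∩ˢ Z) ≐ (Y ∩ˢ Z)
∪-∩-disjointˡ {X} {Y} {Z} d n =
  trans (cong (_∧ Z n) (∨-comm (X n) (Y n))) (∪-∩-disjointʳ {Y} {X} {Z} d n)

∩-∪-disjointʳ : ∀ {X Y Z} → Disjoint X Z → (X ∩ˢ (Y ∪ˢ Z)) ≐ (X ∩ˢ Y)
∩-∪-disjointʳ {X} {Y} {Z} d n =
  trans (∧-comm (X n) _) (trans (∪-∩-disjointʳ {Y} {Z} {X} (Disjoint-sym d) n) (∧-comm (Y n) (X n)))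

∩-∪-disjointˡ : ∀ {X Y Z} → Disjoint X Y → (X ∩ˢ (Y ∪ˢ Z)) ≐ (X ∩ˢ Z)
∩-∪-disjointˡ {X} {Y} {Z} d n =
  trans (∧-comm (X n) _) (trans (∪-∩-disjointˡ {Y} {Z} {X} (Disjoint-sym d) n) (∧-comm (Z n) (X n)))

∪-∩-absorbˡ : ∀ {X Y} → ((X ∪ˢ Y) ∩ˢ X) ≐ X
∪-∩-absorbˡ {X} {Y} n = trans (∧-comm (X n ∨ Y n) (X n)) (∧-abs-∨ (X n) (Y n))

∪-∩-absorbʳ : ∀ {X Y} → ((X ∪ˢ Y) ∩ˢ Y) ≐ Y
∪-∩-absorbʳ {X} {Y} n = trans (cong (_∧ Y n) (∨-comm (X n) (Y n))) (∪-∩-absorbˡ {Y} {X} n)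

∖-∩-disjoint : ∀ {X Y Z} → Disjoint Y Z → ((X ∖ˢ Y) ∩ˢ Z) ≐ (X ∩ˢ Z)
∖-∩-disjoint {X} {Y} {Z} d n = cancel (X n) (Y n) (Z n) (d n)
  where
  cancel : ∀ x y z → (T y → T z → ⊥) → (x ∧ not y) ∧ z ≡ x ∧ z
  cancel x false z _     = cong (_∧ z) (∧-identityʳ x)
  cancel x true false _  = trans (∧-zeroʳ _) (sym (∧-zeroʳ x))
  cancel x true true y⊥z = ⊥-elim (y⊥z tt tt)

∪-∖-disjoint : Disjoint X Y → ((X ∪ˢ Y) ∖ˢ X) ≐ Y
∪-∖-disjoint {X} {Y} d n = cancel (X n) (Y n) (d n)
  where
  cancel : ∀ x y → (T x → T y → ⊥) → (x ∨ y) ∧ not x ≡ y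
  cancel false y _     = ∧-identityʳ y
  cancel true false _  = refl
  cancel true true x⊥y = ⊥-elim (x⊥y tt tt)

∖-⊆ : X ⊆ˢ (Y ∪ˢ Z) → Y ⊆ˢ W → (X ∖ˢ W) ⊆ˢ Z
∖-⊆ {X} {Y} {Z} {W} X⊆Y∪Z Y⊆W n = go (X n) (Y n) (Z n) (W n) (X⊆Y∪Z n) (Y⊆W n)
  where
  go : ∀ x y z w → (T x → T (y ∨ z)) → (T y → T w) → T (x ∧ not w) → T z
  go true false _ false x⇒z _    _  = x⇒z tt
  go true true  _ false _   y⇒w _  = ⊥-elim (y⇒w tt)
  go true _     _ true  _   _   ()
  go false _    _ _     _   _   ()

module AxiomGraphs (𝒜 : AtomSys) where
  open WithAtoms 𝒜

  private
    variable
      A B C A₁ A₂ B₁ B₂ : Fm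
      Γ Δ : List Fm
      G H G₁ G₂ : BLGraph

  names-neg : ∀ A → names (neg A) ≐ names A
  names-neg (atom _ _) n = refl
  names-neg (A ∨F B)   n = cong₂ _∨_ (names-neg A n) (names-neg B n)
  names-neg (A ∧F B)   n = cong₂ _∨_ (names-neg A n) (names-neg B n)

  namesL-++ : ∀ Γ → namesL (Γ ++ Δ) ≐ (namesL Γ ∪ˢ namesL Δ)
  namesL-++         []      n = refl
  namesL-++ {Δ = Δ} (A ∷ Γ) n =
    trans (cong (names A n ∨_) (namesL-++ Γ n)) (sym (∨-assoc (names A n) (namesL Γ n) (namesL Δ n)))

  namesL-↭ : Γ ↭ Δ → namesL Γ ≐ namesL Δ
  namesL-↭ ↭.refl        n = refl
  namesL-↭ (prep A p)    n = cong (names A n ∨_) (namesL-↭ p n)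
  namesL-↭ (swap A B p)  n =
    trans (cong (λ z → names A n ∨ (names B n ∨ z)) (namesL-↭ p n)) (x∙yz≈y∙xz (names A n) (names B n) _)
  namesL-↭ (↭.trans p q) n = trans (namesL-↭ p n) (namesL-↭ q n)

  names⊆namesL : A ∈ Γ → names A ⊆ˢ namesL Γ
  names⊆namesL (here refl) = ⊆-∪ˡ
  names⊆namesL (there A∈Γ) = ⊆-trans (names⊆namesL A∈Γ) ⊆-∪ʳ

  SFL-↭ : Γ ↭ Δ → SFL Γ → SFL Δ
  SFL-↭ ↭.refl        s                     = s
  SFL-↭ (prep A p)    (sA , A⊥xs , s)       =
    sA , Disjoint-mono ⊆-refl (≐⇒⊆ (≐-sym (namesL-↭ p))) A⊥xs , SFL-↭ p s
  SFL-↭ (swap A B p)  (sA , A⊥Bxs , sB , B⊥xs , s) =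
    sB , Disjoint-∪ʳ (Disjoint-sym (Disjoint-mono ⊆-refl ⊆-∪ˡ A⊥Bxs)) (Disjoint-mono ⊆-refl ys⊆xs B⊥xs) ,
    sA , Disjoint-mono ⊆-refl (⊆-trans ys⊆xs ⊆-∪ʳ) A⊥Bxs , SFL-↭ p s
    where ys⊆xs = ≐⇒⊆ (≐-sym (namesL-↭ p))
  SFL-↭ (↭.trans p q) s                     = SFL-↭ q (SFL-↭ p s)

  SFL-++⁻ : ∀ Γ → SFL (Γ ++ Δ) → SFL Γ × Disjoint (namesL Γ) (namesL Δ)
  SFL-++⁻ []      _                 = tt , λ _ ()
  SFL-++⁻ (A ∷ Γ) (sA , A⊥Γ++Δ , s) =
    let (sΓ , Γ⊥Δ) = SFL-++⁻ Γ s in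
    (sA , Disjoint-mono ⊆-refl (⊆-trans ⊆-∪ˡ ++⊆) A⊥Γ++Δ , sΓ) ,
    Disjoint-∪ˡ (Disjoint-mono ⊆-refl (⊆-trans ⊆-∪ʳ ++⊆) A⊥Γ++Δ) Γ⊥Δ
    where ++⊆ = ≐⇒⊆ (≐-sym (namesL-++ Γ))

  SFL-∨∧⁻ˡ : SFL (A₁ ∨F A₂ ∷ B₁ ∧F B₂ ∷ []) → SFL (A₁ ∷ B₁ ∷ A₂ ∷ [])
  SFL-∨∧⁻ˡ {A₁} {A₂} {B₁} {B₂} ((sA₁ , sA₂ , A₁⊥A₂) , A⊥B , (sB₁ , _ , _) , _) =
    sA₁ , Disjoint-∪ʳ A₁⊥B₁ (Disjoint-∪ʳ A₁⊥A₂ Disjoint-∅ʳ) ,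
    sB₁ , Disjoint-∪ʳ (Disjoint-sym A₂⊥B₁) Disjoint-∅ʳ ,
    sA₂ , Disjoint-∅ʳ , tt
    where
    B₁⊆B : names B₁ ⊆ˢ ((names B₁ ∪ˢ names B₂) ∪ˢ ∅ˢ)
    B₁⊆B = ⊆-trans ⊆-∪ˡ ⊆-∪ˡ
    A₁⊥B₁ : Disjoint (names A₁) (names B₁)
    A₁⊥B₁ = Disjoint-mono ⊆-∪ˡ B₁⊆B A⊥B
    A₂⊥B₁ : Disjoint (names A₂) (names B₁)
    A₂⊥B₁ = Disjoint-mono ⊆-∪ʳ B₁⊆B A⊥B

  SFL-∨∧⁻ʳ : SFL (A₁ ∨F A₂ ∷ B₁ ∧F B₂ ∷ []) → SFL (A₂ ∷ B₂ ∷ A₁ ∷ [])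
  SFL-∨∧⁻ʳ {A₁} {A₂} {B₁} {B₂} ((sA₁ , sA₂ , A₁⊥A₂) , A⊥B , (_ , sB₂ , _) , _) =
    sA₂ , Disjoint-∪ʳ A₂⊥B₂ (Disjoint-∪ʳ (Disjoint-sym A₁⊥A₂) Disjoint-∅ʳ) ,
    sB₂ , Disjoint-∪ʳ (Disjoint-sym A₁⊥B₂) Disjoint-∅ʳ ,
    sA₁ , Disjoint-∅ʳ , tt
    where
    B₂⊆B : names B₂ ⊆ˢ ((names B₁ ∪ˢ names B₂) ∪ˢ ∅ˢ)
    B₂⊆B = ⊆-trans (⊆-∪ʳ {X = names B₁}) ⊆-∪ˡ
    A₂⊥B₂ : Disjoint (names A₂) (names B₂)
    A₂⊥B₂ = Disjoint-mono ⊆-∪ʳ B₂⊆B A⊥B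
    A₁⊥B₂ : Disjoint (names A₁) (names B₂)
    A₁⊥B₂ = Disjoint-mono ⊆-∪ˡ B₂⊆B A⊥B

  SFL-conclusion : Deriv Γ → SFL Γ
  SFL-conclusion (ax _ _ _ _ _ s)     = s
  SFL-conclusion (cut _ _ _ s)        = s
  SFL-conclusion (sup _ _ s)          = s
  SFL-conclusion (orR _ _ _ _ _ s)    = s
  SFL-conclusion (andR _ _ _ _ _ _ s) = s

  BrF-resp : ∀ A → X ≐ Y → BrF A X → BrF A Y
  BrF-resp (atom _ _) X≐Y X≐x                    = ≐-trans (≐-sym X≐Y) X≐x
  BrF-resp (A ∨F B)   X≐Y (Y₁ , Y₂ , b₁ , b₂ , e) = Y₁ , Y₂ , b₁ , b₂ , ≐-trans (≐-sym X≐Y) e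
  BrF-resp (A ∧F B)   X≐Y (inj₁ b)               = inj₁ (BrF-resp A X≐Y b)
  BrF-resp (A ∧F B)   X≐Y (inj₂ b)               = inj₂ (BrF-resp B X≐Y b)

  BrL-resp : X ≐ Y → BrL Γ X → BrL Γ Y
  BrL-resp X≐Y (X⊆Γ , br) =
    ⊆-trans (≐⇒⊆ (≐-sym X≐Y)) X⊆Γ ,
    λ {A} A∈Γ → BrF-resp A (λ n → cong (_∧ names A n) (X≐Y n)) (br A∈Γ)

  BrL-↭ : Γ ↭ Δ → BrL Γ X → BrL Δ X
  BrL-↭ p (X⊆Γ , br) = ⊆-trans X⊆Γ (≐⇒⊆ (namesL-↭ p)) , λ A∈Δ → br (∈-resp-↭ (↭-sym p) A∈Δ)

  BrL-++ : Disjoint (namesL Γ) (namesL Δ) → BrL Γ X → BrL Δ Y → BrL (Γ ++ Δ) (X ∪ˢ Y)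
  BrL-++ {Γ} {Δ} {X} {Y} Γ⊥Δ (X⊆Γ , brX) (Y⊆Δ , brY) =
    ⊆-trans (∪-mono X⊆Γ Y⊆Δ) (≐⇒⊆ (≐-sym (namesL-++ Γ))) , br
    where
    br : ∀ {A} → A ∈ Γ ++ Δ → BrF A ((X ∪ˢ Y) ∩ˢ names A)
    br {A} A∈Γ++Δ with ∈-++⁻ Γ A∈Γ++Δ
    ... | inj₁ A∈Γ = BrF-resp A (≐-sym (∪-∩-disjointʳ {X} {Y} {names A}
                       (Disjoint-mono Y⊆Δ (names⊆namesL A∈Γ) (Disjoint-sym Γ⊥Δ)))) (brX A∈Γ)
    ... | inj₂ A∈Δ = BrF-resp A (≐-sym (∪-∩-disjointˡ {X} {Y} {names A}
                       (Disjoint-mono X⊆Γ (names⊆namesL A∈Δ) Γ⊥Δ))) (brY A∈Δ)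

  BrL-∖ : names C ⊆ˢ W → Disjoint W (namesL Γ) → BrL (C ∷ Γ) X → BrL Γ (X ∖ˢ W)
  BrL-∖ {W = W} {X = X} C⊆W W⊥Γ (X⊆CΓ , br) =
    ∖-⊆ X⊆CΓ C⊆W , λ {A} A∈Γ →
      BrF-resp A (≐-sym (∖-∩-disjoint {X} {W} {names A} (Disjoint-mono ⊆-refl (names⊆namesL A∈Γ) W⊥Γ)))
        (br (there A∈Γ))

  BrL-∨ : BrL (A ∷ B ∷ Δ) X → BrL (A ∨F B ∷ Δ) X
  BrL-∨ {A} {B} {Δ} {X} (X⊆ABΔ , br) =
    ⊆-trans X⊆ABΔ (≐⇒⊆ λ n → sym (∨-assoc (names A n) (names B n) (namesL Δ n))) , br′
    where
    br′ : ∀ {C} → C ∈ A ∨F B ∷ Δ → BrF C (X ∩ˢ names C)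
    br′ (here refl) = X ∩ˢ names A , X ∩ˢ names B , br (here refl) , br (there (here refl)) ,
                      λ n → ∧-distribˡ-∨ (X n) (names A n) (names B n)
    br′ (there C∈Δ) = br (there (there C∈Δ))

  BrL-∧ˡ : SFL (A ∧F B ∷ Δ) → BrL (A ∷ Δ) X → BrL (A ∧F B ∷ Δ) X
  BrL-∧ˡ {A} {B} {Δ} {X} ((_ , _ , A⊥B) , AB⊥Δ , _) (X⊆AΔ , br) = ⊆-trans X⊆AΔ AΔ⊆ABΔ , br′
    where
    AΔ⊆ABΔ : (names A ∪ˢ namesL Δ) ⊆ˢ namesL (A ∧F B ∷ Δ)
    AΔ⊆ABΔ = ∪-mono {X = names A ∪ˢ names B} {Z = namesL Δ} ⊆-∪ˡ ⊆-refl
    X⊥B : Disjoint X (names B)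
    X⊥B = Disjoint-mono X⊆AΔ ⊆-refl
            (Disjoint-∪ˡ A⊥B (Disjoint-sym (Disjoint-mono ⊆-∪ʳ ⊆-refl AB⊥Δ)))
    br′ : ∀ {C} → C ∈ A ∧F B ∷ Δ → BrF C (X ∩ˢ names C)
    br′ (here refl) =
      inj₁ (BrF-resp A (≐-sym (∩-∪-disjointʳ {X} {names A} {names B} X⊥B)) (br (here refl)))
    br′ (there C∈Δ) = br (there C∈Δ)

  BrL-∧ʳ : SFL (A ∧F B ∷ Δ) → BrL (B ∷ Δ) X → BrL (A ∧F B ∷ Δ) X
  BrL-∧ʳ {A} {B} {Δ} {X} ((_ , _ , A⊥B) , AB⊥Δ , _) (X⊆BΔ , br) = ⊆-trans X⊆BΔ BΔ⊆ABΔ , br′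
    where
    BΔ⊆ABΔ : (names B ∪ˢ namesL Δ) ⊆ˢ namesL (A ∧F B ∷ Δ)
    BΔ⊆ABΔ = ∪-mono {X = names A ∪ˢ names B} {Z = namesL Δ} ⊆-∪ʳ ⊆-refl
    X⊥A : Disjoint X (names A)
    X⊥A = Disjoint-mono X⊆BΔ ⊆-refl
            (Disjoint-∪ˡ (Disjoint-sym A⊥B) (Disjoint-sym (Disjoint-mono ⊆-∪ˡ ⊆-refl AB⊥Δ)))
    br′ : ∀ {C} → C ∈ A ∧F B ∷ Δ → BrF C (X ∩ˢ names C)
    br′ (here refl) =
      inj₂ (BrF-resp B (≐-sym (∩-∪-disjointˡ {X} {names A} {names B} X⊥A)) (br (here refl)))
    br′ (there C∈Δ) = br (there C∈Δ)

  Fits : BLGraph → List Fm → Set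
  Fits G Γ = V G ≐ namesL Γ × (∀ X → BrG G X → BrL Γ X)

  Fits-↭ : Γ ↭ Δ → Fits G Γ → Fits G Δ
  Fits-↭ p (V≐Γ , br) = ≐-trans V≐Γ (namesL-↭ p) , λ X b → BrL-↭ p (br X b)

  BrG-⊔ : BrG (G ⊔G H) X → BrG G X ⊎ BrG H X
  BrG-⊔ (x , y , inj₁ r) = inj₁ (x , y , r)
  BrG-⊔ (x , y , inj₂ r) = inj₂ (x , y , r)

  Fits-⊔ : Fits G Γ → Fits H Γ → Fits (G ⊔G H) Γ
  Fits-⊔ {G = G} {Γ = Γ} {H = H} (VG≐Γ , brG) (VH≐Γ , brH) =
    (λ n → trans (cong₂ _∨_ (VG≐Γ n) (VH≐Γ n)) (∨-idem (namesL Γ n))) ,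
    λ X b → [ brG X , brH X ]′ (BrG-⊔ {G = G} {H = H} b)

  Fits-∨ : Fits G (A ∷ B ∷ Δ) → Fits G (A ∨F B ∷ Δ)
  Fits-∨ {A = A} {B} {Δ} (V≐ABΔ , br) =
    (λ n → trans (V≐ABΔ n) (sym (∨-assoc (names A n) (names B n) (namesL Δ n)))) ,
    λ X b → BrL-∨ (br X b)

  Fits-∧ : SFL (A ∧F B ∷ Δ) → Fits G (A ∷ Δ) → Fits H (B ∷ Δ) → Fits (G ⊔G H) (A ∧F B ∷ Δ)
  Fits-∧ {A = A} {B = B} {Δ = Δ} {G = G} {H = H} s (VG≐AΔ , brG) (VH≐BΔ , brH) =
    (λ n → trans (cong₂ _∨_ (VG≐AΔ n) (VH≐BΔ n))
                 (sym (∙-distrʳ-∙ (namesL Δ n) (names A n) (names B n)))) ,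
    λ X b → [ BrL-∧ˡ s ∘ brG X , BrL-∧ʳ s ∘ brH X ]′ (BrG-⊔ {G = G} {H = H} b)

  Fits-wk : Disjoint (namesL Γ) (namesL Δ) → Fits G Γ → Fits (wk Δ G) (Γ ++ Δ)
  Fits-wk {Γ} {Δ} Γ⊥Δ (V≐Γ , br) =
    (λ n → trans (cong (_∨ namesL Δ n) (V≐Γ n)) (sym (namesL-++ Γ n))) ,
    λ { Z (x , y , X , Y , r , bY , Z≐X∪Y) →
          BrL-resp (≐-sym Z≐X∪Y) (BrL-++ Γ⊥Δ (br X (x , y , r)) bY) }

  Alt-first-edge : ∀ xs → Alt G H W X xs → ∃[ Y ] (BrG G Y × X ≐ (Y ∖ˢ W))
  Alt-first-edge (x ∷ y ∷ [])    (Y , r , X≐Y∖W)     = Y , (x , y , r) , X≐Y∖W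
  Alt-first-edge (x ∷ y ∷ _ ∷ _) ((Y , r , X≐Y∖W) , _) = Y , (x , y , r) , X≐Y∖W

  -- witnessed by the first edge of the complete alternating path
  BrG-⊙ : BrG (comp W G H) X → ∃[ Y ] ((BrG G Y ⊎ BrG H Y) × X ≐ (Y ∖ˢ W))
  BrG-⊙ (_ , _ , _ , _ , _ , _ , _ , _ , _ , _ , _ , _ , inj₁ alt) =
    let (Y , b , X≐Y∖W) = Alt-first-edge _ alt in Y , inj₁ b , X≐Y∖W
  BrG-⊙ (_ , _ , _ , _ , _ , _ , _ , _ , _ , _ , _ , _ , inj₂ alt) =
    let (Y , b , X≐Y∖W) = Alt-first-edge _ alt in Y , inj₂ b , X≐Y∖W

  Fits-⊙ : Disjoint (names A) (namesL Γ) → Fits G (A ∷ Γ) → Fits H (neg A ∷ Γ) →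
           Fits (comp (names A) G H) Γ
  Fits-⊙ {A} {Γ} {G} {H} A⊥Γ (VG≐AΓ , brG) (VH≐¬AΓ , brH) = V≐Γ , br
    where
    V≐Γ : V (comp (names A) G H) ≐ namesL Γ
    V≐Γ n = trans (cong (_∧ not (names A n)) (trans (cong₂ _∨_ (VG≐AΓ n) VH≐AΓ) (∨-idem _)))
                  (∪-∖-disjoint A⊥Γ n)
      where VH≐AΓ = trans (VH≐¬AΓ n) (cong (_∨ namesL Γ n) (names-neg A n))
    br : ∀ X → BrG (comp (names A) G H) X → BrL Γ X
    br X b with BrG-⊙ b
    ... | Y , inj₁ bG , X≐Y∖A = BrL-resp (≐-sym X≐Y∖A) (BrL-∖ ⊆-refl A⊥Γ (brG Y bG))
    ... | Y , inj₂ bH , X≐Y∖A = BrL-resp (≐-sym X≐Y∖A) (BrL-∖ (≐⇒⊆ (names-neg A)) A⊥Γ (brH Y bH))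

  Fits-idG-atoms : ∀ a x b y → Fits (idG (atom a x) (atom b y)) (atom a x ∷ atom b y ∷ [])
  Fits-idG-atoms a x b y = xy≐names , λ { X (_ , _ , _ , X≐xy) → BrL-resp (≐-sym X≐xy) xy∈Br }
    where
    xy≐names : (｛ x ｝ ∪ˢ ｛ y ｝) ≐ namesL (atom a x ∷ atom b y ∷ [])
    xy≐names n = cong (｛ x ｝ n ∨_) (sym (∨-identityʳ (｛ y ｝ n)))
    xy∈Br : BrL (atom a x ∷ atom b y ∷ []) (｛ x ｝ ∪ˢ ｛ y ｝)
    xy∈Br = ≐⇒⊆ xy≐names , λ where
      (here refl)         → ∪-∩-absorbˡ {｛ x ｝} {｛ y ｝}
      (there (here refl)) → ∪-∩-absorbʳ {｛ x ｝} {｛ y ｝}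
      (there (there ()))

  -- The pairs on which idG follows the recursion of id; on every other pair it is empty.
  data Dual : Fm → Fm → Set where
    atom-atom : ∀ a x b y → Dual (atom a x) (atom b y)
    ∨-∧       : Dual A₁ B₁ → Dual A₂ B₂ → Dual (A₁ ∨F A₂) (B₁ ∧F B₂)
    ∧-∨       : Dual B₁ A₁ → Dual B₂ A₂ → Dual (A₁ ∧F A₂) (B₁ ∨F B₂)

  Dual-sym : Dual A B → Dual B A
  Dual-sym (atom-atom a x b y) = atom-atom b y a x
  Dual-sym (∨-∧ d₁ d₂)         = ∧-∨ d₁ d₂
  Dual-sym (∧-∨ d₁ d₂)         = ∨-∧ d₁ d₂

  ∨U-injective : ∀ {a b c d} → (a ∨U b) ≡ (c ∨U d) → a ≡ c × b ≡ d
  ∨U-injective refl = refl , refl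

  ∧U-injective : ∀ {a b c d} → (a ∧U b) ≡ (c ∧U d) → a ≡ c × b ≡ d
  ∧U-injective refl = refl , refl

  ≅⇒Dual-neg : ∀ A B → A ≅ B → Dual A (neg B)
  ≅⇒Dual-neg (atom a x) (atom b y) _ = atom-atom a x _ y
  ≅⇒Dual-neg (A₁ ∨F A₂) (B₁ ∨F B₂) e =
    let (e₁ , e₂) = ∨U-injective e in ∨-∧ (≅⇒Dual-neg A₁ B₁ e₁) (≅⇒Dual-neg A₂ B₂ e₂)
  ≅⇒Dual-neg (A₁ ∧F A₂) (B₁ ∧F B₂) e =
    let (e₁ , e₂) = ∧U-injective e in
    ∧-∨ (Dual-sym (≅⇒Dual-neg A₁ B₁ e₁)) (Dual-sym (≅⇒Dual-neg A₂ B₂ e₂))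
  ≅⇒Dual-neg (atom _ _) (_ ∨F _)   ()
  ≅⇒Dual-neg (atom _ _) (_ ∧F _)   ()
  ≅⇒Dual-neg (_ ∨F _)   (atom _ _) ()
  ≅⇒Dual-neg (_ ∨F _)   (_ ∧F _)   ()
  ≅⇒Dual-neg (_ ∧F _)   (atom _ _) ()
  ≅⇒Dual-neg (_ ∧F _)   (_ ∨F _)   ()

  Fits-∨∧ : (SFL (A₁ ∷ B₁ ∷ []) → Fits G₁ (A₁ ∷ B₁ ∷ [])) →
            (SFL (A₂ ∷ B₂ ∷ []) → Fits G₂ (A₂ ∷ B₂ ∷ [])) →
            SFL (A₁ ∨F A₂ ∷ B₁ ∧F B₂ ∷ []) →
            Fits (wk (A₂ ∷ []) G₁ ⊔G wk (A₁ ∷ []) G₂) (A₁ ∨F A₂ ∷ B₁ ∧F B₂ ∷ [])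
  Fits-∨∧ {A₁} {B₁} {G₁} {A₂} {B₂} {G₂} fits₁ fits₂ s =
    Fits-↭ (swap (B₁ ∧F B₂) (A₁ ∨F A₂) ↭.refl)
      (Fits-∧ (SFL-↭ (swap (A₁ ∨F A₂) (B₁ ∧F B₂) ↭.refl) s) left right)
    where
    left : Fits (wk (A₂ ∷ []) G₁) (B₁ ∷ A₁ ∨F A₂ ∷ [])
    left = let (s₁ , A₁B₁⊥A₂) = SFL-++⁻ (A₁ ∷ B₁ ∷ []) (SFL-∨∧⁻ˡ s) in
      Fits-↭ (swap _ _ ↭.refl)
        (Fits-∨ (Fits-↭ (prep A₁ (swap B₁ A₂ ↭.refl)) (Fits-wk A₁B₁⊥A₂ (fits₁ s₁))))
    right : Fits (wk (A₁ ∷ []) G₂) (B₂ ∷ A₁ ∨F A₂ ∷ [])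
    right = let (s₂ , A₂B₂⊥A₁) = SFL-++⁻ (A₂ ∷ B₂ ∷ []) (SFL-∨∧⁻ʳ s) in
      Fits-↭ (swap _ _ ↭.refl)
        (Fits-∨ (Fits-↭ (↭.trans (prep A₂ (swap B₂ A₁ ↭.refl)) (swap A₂ A₁ ↭.refl))
                        (Fits-wk A₂B₂⊥A₁ (fits₂ s₂))))

  Fits-idG : Dual A B → SFL (A ∷ B ∷ []) → Fits (idG A B) (A ∷ B ∷ [])
  Fits-idG (atom-atom a x b y) _ = Fits-idG-atoms a x b y
  Fits-idG (∨-∧ d₁ d₂)           = Fits-∨∧ (Fits-idG d₁) (Fits-idG d₂)
  Fits-idG {A₁ ∧F A₂} {B₁ ∨F B₂} (∧-∨ d₁ d₂) s =
    Fits-↭ (swap (B₁ ∨F B₂) (A₁ ∧F A₂) ↭.refl)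
      (Fits-∨∧ (Fits-idG d₁) (Fits-idG d₂) (SFL-↭ (swap (A₁ ∧F A₂) (B₁ ∨F B₂) ↭.refl) s))

  graph-fits : (P : Deriv Γ) → Fits (graph P) Γ
  graph-fits (ax Δ A B p A≅B s) =
    let (sAB , AB⊥Δ) = SFL-++⁻ (A ∷ neg B ∷ []) (SFL-↭ p s) in
    Fits-↭ (↭-sym p) (Fits-wk AB⊥Δ (Fits-idG (≅⇒Dual-neg A B A≅B) sAB))
  graph-fits (cut A Q R _)        =
    Fits-⊙ (proj₁ (proj₂ (SFL-conclusion Q))) (graph-fits Q) (graph-fits R)
  graph-fits (sup Q R _)          = Fits-⊔ (graph-fits Q) (graph-fits R)
  graph-fits (orR Δ A B p Q _)    = Fits-↭ (↭-sym p) (Fits-∨ (graph-fits Q))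
  graph-fits (andR Δ A B p Q R s) =
    Fits-↭ (↭-sym p) (Fits-∧ (SFL-↭ p s) (graph-fits Q) (graph-fits R))

proposition4 : (𝒜 : AtomSys) → let open WithAtoms 𝒜 in
    ∀ {Γ : List Fm} (P : Deriv Γ) →
      (∀ n → V (graph P) n ≡ namesL Γ n) × (∀ X → BrG (graph P) X → BrL Γ X)
proposition4 𝒜 = AxiomGraphs.graph-fits 𝒜
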